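{- Let $G$ be a fascinating graph which is $2$-joinlike, witnessed by a partition $V(G)=C_1\sqcup C_2\sqcup X$ with $|X|=2$, and let $q\in X$ be any exceptional vertex. Then $\deg(q,C_i)\geq 2$ for $i=1,2$.
   Context: For a graph $G$ and a vertex $v$, $N_v=\{w: vw\in E(G)\}$, and for $Y\subseteq V(G)$, $\deg(v,Y)=|N_v\cap Y|$; $G[W]$ is the subgraph induced by $W$. For a clique $\sigma$, $\mathrm{lk}_G\sigma$ is the subgraph induced by $\bigcap_{v\in\sigma}N_v$. The length of a cycle is its number of vertices. A graph $G$ with $n$ vertices and $m$ edges is fascinating if: (a) $G$ contains exactly $2(m-n)$ triangles; (b) for every edge $e$, $\mathrm{lk}_G e$ is a cycle of length at least $4$; (c) for every triangle $t$, $\mathrm{lk}_G t$ is the graph with $2$ vertices and no edges; (d) for every vertex $v$, $\mathrm{lk}_G v$ is a connected planar graph whose every face (including the unbounded one) is a triangle, with at least $6$ vertices. A fascinating graph $G$ is $t$-joinlike if there is a partition $V(G)=C_1\sqcup C_2\sqcup X$ such that $G[C_1]$ and $G[C_2]$ are cycles, there are edges $e_i\in G[C_i]$ with $\mathrm{lk}_G e_i=G[C_{3-i}]$ for $i=1,2$, and $|X|=t$; the vertices of $X$ are called exceptional. -}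

module Defs where

open import Data.Nat using (ℕ; zero; suc; _+_; _*_; _≤_; _<ᵇ_)
open import Data.Fin using (Fin; toℕ)
open import Data.Bool using (Bool; true; false; _∧_; if_then_else_)
open import Data.Product using (Σ; ∃; _×_; _,_)
open import Data.Sum using (_⊎_)
open import Relation.Binary.PropositionalEquality using (_≡_)
open import Function.Bundles using (_⇔_)
open import Function.Definitions using (Injective)

record Graph (n : ℕ) : Set where
  field
    adj    : Fin n → Fin n → Bool
    sym    : ∀ x y → adj x y ≡ adj y x
    irrefl : ∀ x → adj x x ≡ false
open Graph public

Subset : ℕ → Set
Subset n = Fin n → Bool

sumF : ∀ {n} → (Fin n → ℕ) → ℕ
sumF {zero}  f = 0
sumF {suc n} f = f Fin.zero + sumF (λ i → f (Fin.suc i))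

χ : Bool → ℕ
χ b = if b then 1 else 0

count : ∀ {n} → (Fin n → Bool) → ℕ
count p = sumF (λ i → χ (p i))

_<F_ : ∀ {n} → Fin n → Fin n → Bool
i <F j = toℕ i <ᵇ toℕ j

module _ {n : ℕ} (G : Graph n) where

  numEdges : ℕ
  numEdges = sumF λ x → count λ y → (x <F y) ∧ adj G x y

  numTriangles : ℕ
  numTriangles = sumF λ x → sumF λ y → count λ z →
    (x <F y) ∧ (y <F z) ∧ adj G x y ∧ adj G y z ∧ adj G x z

  N : Fin n → Subset n
  N v = adj G v

  deg : Fin n → Subset n → ℕ
  deg v Y = count λ w → adj G v w ∧ Y w

  -- vertex sets of links of cliques: lk v, lk {a,b}, lk {a,b,c}
  lkV : Fin n → Subset n
  lkV v = N v

  lkE : Fin n → Fin n → Subset n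
  lkE a b w = N a w ∧ N b w

  lkT : Fin n → Fin n → Fin n → Subset n
  lkT a b c w = N a w ∧ N b w ∧ N c w

-- A (symmetric) Boolean relation R restricted to a vertex set P
-- "is a cycle of length k" if there is a bijection f : Fin k → P
-- (k ≥ 3) such that f i, f j are R-related iff i, j are cyclically
-- consecutive in Z/k.  For an induced subgraph G[P] take R = adj G.

CycAdj : (k : ℕ) → Fin k → Fin k → Set
CycAdj k i j =
    (toℕ j ≡ suc (toℕ i))
  ⊎ (toℕ i ≡ suc (toℕ j))
  ⊎ (toℕ i ≡ 0 × suc (toℕ j) ≡ k)
  ⊎ (toℕ j ≡ 0 × suc (toℕ i) ≡ k)

IsCycleOfLength : ∀ {n} → (Fin n → Fin n → Bool) → Subset n → ℕ → Set
IsCycleOfLength {n} R P k =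
  3 ≤ k × Σ (Fin k → Fin n) λ f →
      Injective _≡_ _≡_ f
    × (∀ x → P x ≡ true ⇔ ∃ λ i → f i ≡ x)
    × (∀ i j → R (f i) (f j) ≡ true ⇔ CycAdj k i j)

IsCycle : ∀ {n} → (Fin n → Fin n → Bool) → Subset n → Set
IsCycle R P = ∃ λ k → IsCycleOfLength R P k

data Reach {n} (R : Fin n → Fin n → Bool) (P : Subset n) : Fin n → Fin n → Set where
  here : ∀ {x} → Reach R P x x
  step : ∀ {x y z} → R x y ≡ true → P y ≡ true → Reach R P y z → Reach R P x z

Connected : ∀ {n} → (Fin n → Fin n → Bool) → Subset n → Set
Connected R P = ∀ x y → P x ≡ true → P y ≡ true → Reach R P x y

-- The graph H = G[P] is a connected planar graph with every face a
-- triangle iff it is the 1-skeleton of a triangulated 2-sphere: there is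
-- a set F of facial triangles of H (a symmetric Boolean predicate on
-- triples) such that
--   * around every vertex v of H the faces containing v form a single
--     cycle through all neighbours of v in H (closed surface: the link of
--     v in the face structure is a cycle), and
--   * H is connected and the Euler characteristic V - E + F equals 2
--     (so the surface is a sphere, i.e. the embedding is planar).

module _ {n : ℕ} (G : Graph n) (P : Subset n) where

  private
    A : Fin n → Fin n → Bool
    A x y = P x ∧ P y ∧ adj G x y

  record SphereTriangulation : Set where
    field
      face      : Fin n → Fin n → Fin n → Bool
      face-sym₁ : ∀ a b c → face a b c ≡ face b a c
      face-sym₂ : ∀ a b c → face a b c ≡ face a c b
      face-tri  : ∀ a b c → face a b c ≡ true →
                    (A a b ∧ A b c ∧ A a c) ≡ true
      face-link : ∀ v → P v ≡ true →
                    IsCycle (face v) (λ w → A v w)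
      euler     : count P
                    + (sumF λ x → sumF λ y → count λ z →
                         (x <F y) ∧ (y <F z) ∧ face x y z)
                  ≡ (sumF λ x → count λ y → (x <F y) ∧ A x y) + 2

  PlanarTriangulated : Set
  PlanarTriangulated = Connected (adj G) P × SphereTriangulation

record Fascinating {n : ℕ} (G : Graph n) : Set where
  field
    -- (a) exactly 2(m - n) triangles
    triangles : numTriangles G + 2 * n ≡ 2 * numEdges G
    edgeLink  : ∀ a b → adj G a b ≡ true →
                  ∃ λ k → 4 ≤ k × IsCycleOfLength (adj G) (lkE G a b) k
    triLink   : ∀ a b c → adj G a b ≡ true → adj G b c ≡ true → adj G a c ≡ true →
                  count (lkT G a b c) ≡ 2
                  × (∀ x y → lkT G a b c x ≡ true → lkT G a b c y ≡ true → adj G x y ≡ false)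
    vertLink  : ∀ v → PlanarTriangulated G (lkV G v) × 6 ≤ count (lkV G v)

data Part : Set where
  c₁ c₂ ex : Part

isC₁ isC₂ isX : Part → Bool
isC₁ c₁ = true
isC₁ _  = false
isC₂ c₂ = true
isC₂ _  = false
isX ex = true
isX _  = false

module _ {n : ℕ} (lab : Fin n → Part) where
  C₁ C₂ X : Subset n
  C₁ v = isC₁ (lab v)
  C₂ v = isC₂ (lab v)
  X  v = isX (lab v)

record Joinlike {n : ℕ} (G : Graph n) (lab : Fin n → Part) (t : ℕ) : Set where
  field
    cyc₁ : IsCycle (adj G) (C₁ lab)
    cyc₂ : IsCycle (adj G) (C₂ lab)
    a₁ b₁ : Fin n
    e₁-in : C₁ lab a₁ ≡ true × C₁ lab b₁ ≡ true × adj G a₁ b₁ ≡ true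
    e₁-lk : ∀ w → lkE G a₁ b₁ w ≡ C₂ lab w
    a₂ b₂ : Fin n
    e₂-in : C₂ lab a₂ ≡ true × C₂ lab b₂ ≡ true × adj G a₂ b₂ ≡ true
    e₂-lk : ∀ w → lkE G a₂ b₂ w ≡ C₁ lab w
    sizeX : count (X lab) ≡ t

{-# OPTIONS --safe #-}
-- Suppose deg(q, Cᵢ) ≤ 1 and let C be the other cycle, with an edge ab of G[C] whose link is
-- G[Cᵢ].  As q is one of only two exceptional vertices, q then has at most two neighbours
-- outside C.  Since lk q has at least six vertices, q has a neighbour w in C.  If a cycle
-- neighbour of w in C were not adjacent to q, the link of the edge qw (a cycle of length at
-- least 4) would meet C in at most one vertex and lie outside C in at most two, too few.  So
-- the neighbours of q on the cycle C propagate around it, q is adjacent to a and b, and q lies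
-- in lk ab = Cᵢ, contradicting q ∈ X.
module Submission where

open import Defs hiding (sym)
open import Data.Nat using (ℕ; zero; suc; _+_; _≤_; _<_; z≤n; s≤s; s≤s⁻¹)
open import Data.Nat.Properties
  using (≤-refl; ≤-reflexive; ≤-trans; <⇒≢; +-cancelˡ-≤; +-mono-≤; +-mono-≤-<; ≰⇒>; +-commutativeSemigroup; module ≤-Reasoning)
open import Algebra.Properties.CommutativeSemigroup +-commutativeSemigroup using (interchange)
open import Data.Fin using (Fin; zero; suc; toℕ; inject₁; _≟_)
open import Data.Fin.Properties using (toℕ-injective; toℕ<n; toℕ-inject₁; suc-injective; 0≢1+n)
open import Data.Fin.Induction using (<-weakInduction)
open import Data.Bool using (Bool; true; false; _∧_; _∨_; not)
open import Data.Product using (Σ; ∃; _×_; _,_; proj₁; proj₂)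
open import Data.Sum using (_⊎_; inj₁; inj₂)
open import Data.Empty using (⊥-elim)
open import Function using (_∘_; id)
open import Function.Bundles using (Equivalence)
open import Function.Definitions using (Injective)
open import Relation.Nullary using (does)
open import Relation.Nullary.Decidable using (dec-true; dec-false)
open import Relation.Binary.PropositionalEquality using (_≡_; _≢_; refl; sym; trans; cong)
import Data.Nat.Properties as ℕ

_⊆_ : ∀ {n} → Subset n → Subset n → Set
P ⊆ Q = ∀ x → P x ≡ true → Q x ≡ true

_∩_ _∪_ : ∀ {n} → Subset n → Subset n → Subset n
(P ∩ Q) x = P x ∧ Q x
(P ∪ Q) x = P x ∨ Q x

∁ : ∀ {n} → Subset n → Subset n
∁ P x = not (P x)

⁅_⁆ : ∀ {n} → Fin n → Subset n
⁅ a ⁆ x = does (x ≟ a)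

∧-true : ∀ {b c} → b ∧ c ≡ true → b ≡ true × c ≡ true
∧-true {true} {true} _ = refl , refl

true≢false : true ≢ false
true≢false ()

∩-monoˡ : ∀ {n} {P Q R : Subset n} → P ⊆ Q → (P ∩ R) ⊆ (Q ∩ R)
∩-monoˡ P⊆Q x h with ∧-true h
... | Px , Rx rewrite P⊆Q x Px | Rx = refl

∩-monoʳ : ∀ {n} {P Q R : Subset n} → Q ⊆ R → (P ∩ Q) ⊆ (P ∩ R)
∩-monoʳ {P = P} Q⊆R x h with P x
... | true = Q⊆R x h

∩-⊆ˡ : ∀ {n} (P Q : Subset n) → (P ∩ Q) ⊆ P
∩-⊆ˡ P Q x = proj₁ ∘ ∧-true

∩-⊆ʳ : ∀ {n} (P Q : Subset n) → (P ∩ Q) ⊆ Q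
∩-⊆ʳ P Q x = proj₂ ∘ ∧-true

χ-mono : ∀ {b c} → (b ≡ true → c ≡ true) → χ b ≤ χ c
χ-mono {false} _ = z≤n
χ-mono {true} h rewrite h refl = ≤-refl

count-mono : ∀ {n} {P Q : Subset n} → P ⊆ Q → count P ≤ count Q
count-mono {zero} _ = z≤n
count-mono {suc n} P⊆Q = +-mono-≤ (χ-mono (P⊆Q zero)) (count-mono (P⊆Q ∘ suc))

count-mono-< : ∀ {n} {P Q : Subset n} {a} → P ⊆ Q → P a ≡ false → Q a ≡ true → count P < count Q
count-mono-< {suc n} {P} {Q} {zero} P⊆Q Pa Qa rewrite Pa | Qa = s≤s (count-mono (P⊆Q ∘ suc))
count-mono-< {suc n} {a = suc a} P⊆Q Pa Qa =
  +-mono-≤-< (χ-mono (P⊆Q zero)) (count-mono-< (P⊆Q ∘ suc) Pa Qa)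

count-≤-+ : ∀ {n} {P Q R : Subset n} → (∀ x → χ (P x) ≤ χ (Q x) + χ (R x)) →
            count P ≤ count Q + count R
count-≤-+ {zero} _ = z≤n
count-≤-+ {suc n} {P} {Q} {R} h = begin
  χ (P zero) + count (P ∘ suc)
    ≤⟨ +-mono-≤ (h zero) (count-≤-+ (h ∘ suc)) ⟩
  (χ (Q zero) + χ (R zero)) + (count (Q ∘ suc) + count (R ∘ suc))
    ≡⟨ interchange (χ (Q zero)) (χ (R zero)) (count (Q ∘ suc)) (count (R ∘ suc)) ⟩
  count Q + count R ∎
  where open ≤-Reasoning

count-∩-∪ : ∀ {n} (P Q R : Subset n) → count (P ∩ (Q ∪ R)) ≤ count (P ∩ Q) + count (P ∩ R)
count-∩-∪ P Q R = count-≤-+ λ x → pointwise (P x) (Q x) (R x)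
  where
  pointwise : ∀ p q r → χ (p ∧ (q ∨ r)) ≤ χ (p ∧ q) + χ (p ∧ r)
  pointwise false _     _ = z≤n
  pointwise true  true  _ = s≤s z≤n
  pointwise true  false r = ≤-refl

count-split : ∀ {n} (P Q : Subset n) → count P ≤ count (P ∩ ∁ Q) + count (P ∩ Q)
count-split P Q = count-≤-+ λ x → pointwise (P x) (Q x)
  where
  pointwise : ∀ p q → χ p ≤ χ (p ∧ not q) + χ (p ∧ q)
  pointwise false _     = z≤n
  pointwise true  false = ≤-refl
  pointwise true  true  = ≤-refl

count-∅ : ∀ {n} {P : Subset n} → (∀ x → P x ≢ true) → count P ≡ 0
count-∅ {zero} _ = refl
count-∅ {suc n} {P} h with P zero in P0
... | true  = ⊥-elim (h zero P0)
... | false = count-∅ (h ∘ suc)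

count≤1 : ∀ {n} {P : Subset n} → (∀ x y → P x ≡ true → P y ≡ true → x ≡ y) → count P ≤ 1
count≤1 {zero} _ = z≤n
count≤1 {suc n} {P} unique with P zero in P0
... | true  = s≤s (≤-reflexive (count-∅ λ x Px → 0≢1+n (unique zero (suc x) P0 Px)))
... | false = count≤1 λ x y Px Py → suc-injective (unique (suc x) (suc y) Px Py)

0<count⇒∃ : ∀ {n} {P : Subset n} → 0 < count P → ∃ λ x → P x ≡ true
0<count⇒∃ {suc n} {P} pos with P zero in P0
... | true  = zero , P0
... | false with 0<count⇒∃ pos
...   | x , Px = suc x , Px

injective⇒≤count : ∀ {n k} {P : Subset n} (f : Fin k → Fin n) → Injective _≡_ _≡_ f →
                   (∀ i → P (f i) ≡ true) → k ≤ count P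
injective⇒≤count {k = zero} _ _ _ = z≤n
injective⇒≤count {k = suc k} {P} f f-inj Pf =
  ≤-trans (s≤s (injective⇒≤count (f ∘ suc) (suc-injective ∘ f-inj) P′-f∘suc))
          (count-mono-< (∩-⊆ˡ P (∁ ⁅ f zero ⁆)) P′-f₀ (Pf zero))
  where
  P′-f₀ : (P ∩ ∁ ⁅ f zero ⁆) (f zero) ≡ false
  P′-f₀ rewrite dec-true (f zero ≟ f zero) refl | Pf zero = refl
  P′-f∘suc : ∀ i → (P ∩ ∁ ⁅ f zero ⁆) (f (suc i)) ≡ true
  P′-f∘suc i rewrite dec-false (f (suc i) ≟ f zero) (0≢1+n ∘ sym ∘ f-inj) | Pf (suc i) = refl

cycleLength≤count : ∀ {n} {R : Fin n → Fin n → Bool} {P : Subset n} {k} →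
                    IsCycleOfLength R P k → k ≤ count P
cycleLength≤count (_ , f , f-inj , P⇔image , _) =
  injective⇒≤count f f-inj λ i → Equivalence.from (P⇔image (f i)) (i , refl)

CycSucc CycPred : ∀ {k} → Fin k → Fin k → Set
CycSucc {k} i j = toℕ j ≡ suc (toℕ i) ⊎ (toℕ j ≡ 0 × suc (toℕ i) ≡ k)
CycPred {k} i j = CycSucc j i

CycAdj⇒Succ⊎Pred : ∀ {k} {i j : Fin k} → CycAdj k i j → CycSucc i j ⊎ CycPred i j
CycAdj⇒Succ⊎Pred (inj₁ e)                = inj₁ (inj₁ e)
CycAdj⇒Succ⊎Pred (inj₂ (inj₁ e))         = inj₂ (inj₁ e)
CycAdj⇒Succ⊎Pred (inj₂ (inj₂ (inj₁ e))) = inj₂ (inj₂ e)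
CycAdj⇒Succ⊎Pred (inj₂ (inj₂ (inj₂ e))) = inj₁ (inj₂ e)

CycSucc-unique : ∀ {k} {i a b : Fin k} → CycSucc i a → CycSucc i b → a ≡ b
CycSucc-unique (inj₁ a≡) (inj₁ b≡) = toℕ-injective (trans a≡ (sym b≡))
CycSucc-unique {a = a} (inj₁ a≡) (inj₂ (_ , i+1≡k)) = ⊥-elim (<⇒≢ (toℕ<n a) (trans a≡ i+1≡k))
CycSucc-unique {b = b} (inj₂ (_ , i+1≡k)) (inj₁ b≡) = ⊥-elim (<⇒≢ (toℕ<n b) (trans b≡ i+1≡k))
CycSucc-unique (inj₂ (a≡0 , _)) (inj₂ (b≡0 , _)) = toℕ-injective (trans a≡0 (sym b≡0))

CycPred-unique : ∀ {k} {i a b : Fin k} → CycPred i a → CycPred i b → a ≡ b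
CycPred-unique (inj₁ i≡) (inj₁ i≡′) = toℕ-injective (ℕ.suc-injective (trans (sym i≡) i≡′))
CycPred-unique (inj₁ i≡) (inj₂ (i≡0 , _)) with () ← trans (sym i≡) i≡0
CycPred-unique (inj₂ (i≡0 , _)) (inj₁ i≡) with () ← trans (sym i≡) i≡0
CycPred-unique (inj₂ (_ , a+1≡k)) (inj₂ (_ , b+1≡k)) =
  toℕ-injective (ℕ.suc-injective (trans a+1≡k (sym b+1≡k)))

CycAdj-atMostTwo : ∀ {k} {i a b c : Fin k} → CycAdj k i a → CycAdj k i b → CycAdj k i c →
                   a ≡ b ⊎ a ≡ c ⊎ b ≡ c
CycAdj-atMostTwo i~a i~b i~c
  with CycAdj⇒Succ⊎Pred i~a | CycAdj⇒Succ⊎Pred i~b | CycAdj⇒Succ⊎Pred i~c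
... | inj₁ sa | inj₁ sb | _      = inj₁ (CycSucc-unique sa sb)
... | inj₂ pa | inj₂ pb | _      = inj₁ (CycPred-unique pa pb)
... | inj₁ sa | inj₂ _  | inj₁ sc = inj₂ (inj₁ (CycSucc-unique sa sc))
... | inj₁ _  | inj₂ pb | inj₂ pc = inj₂ (inj₂ (CycPred-unique pb pc))
... | inj₂ _  | inj₁ sb | inj₁ sc = inj₂ (inj₂ (CycSucc-unique sb sc))
... | inj₂ pa | inj₁ _  | inj₂ pc = inj₂ (inj₁ (CycPred-unique pa pc))

CycAdj-connected : ∀ {k} (P : Fin k → Set) → (∀ {i j} → CycAdj k i j → P i → P j) →
                   ∀ {i} → P i → ∀ j → P j
CycAdj-connected {suc k} P closed {i} Pi j = proj₁ (↔P₀ j) (proj₂ (↔P₀ i) Pi)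
  where
  ↔P₀ : ∀ j → (P zero → P j) × (P j → P zero)
  ↔P₀ = <-weakInduction (λ j → (P zero → P j) × (P j → P zero)) (id , id)
    λ i (to , from) → closed (inj₁ (next i)) ∘ to , from ∘ closed (inj₂ (inj₁ (next i)))
    where
    next : ∀ (i : Fin k) → toℕ (suc i) ≡ suc (toℕ (inject₁ i))
    next i = cong suc (sym (toℕ-inject₁ i))

module _ {n} (G : Graph n) where

  deg-∪ : ∀ v (A B : Subset n) → deg G v (A ∪ B) ≤ deg G v A + deg G v B
  deg-∪ v = count-∩-∪ (N G v)

  deg-mono : ∀ v {A B : Subset n} → A ⊆ B → deg G v A ≤ deg G v B
  deg-mono v = count-mono ∘ ∩-monoʳ

  deg<count : ∀ {v} {A : Subset n} → A v ≡ true → deg G v A < count A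
  deg<count {v} {A} Av = count-mono-< (∩-⊆ʳ (N G v) A) v∉N Av
    where
    v∉N : (N G v ∩ A) v ≡ false
    v∉N rewrite irrefl G v = refl

  module _ {C : Subset n} {k} {f : Fin k → Fin n}
           (C⊆image : ∀ x → C x ≡ true → ∃ λ i → f i ≡ x)
           (adj⇒CycAdj : ∀ i j → adj G (f i) (f j) ≡ true → CycAdj k i j) where

    count-lkE∩C≤1 : ∀ q {i j} → CycAdj k i j → adj G q (f j) ≡ false →
                    count (lkE G q (f i) ∩ C) ≤ 1
    count-lkE∩C≤1 q {i} {j} i~j q≁fj = count≤1 unique
      where
      onCycle : ∀ x → (lkE G q (f i) ∩ C) x ≡ true →
                Σ (Fin k) λ a → f a ≡ x × adj G q x ≡ true × CycAdj k i a
      onCycle x h with adj G q x | adj G (f i) x in fix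
      ... | true | true with C⊆image x h
      ...   | a , refl = a , refl , refl , adj⇒CycAdj i a fix
      unique : ∀ x y → (lkE G q (f i) ∩ C) x ≡ true → (lkE G q (f i) ∩ C) y ≡ true → x ≡ y
      unique x y hx hy with onCycle x hx | onCycle y hy
      ... | a , refl , qa , i~a | b , refl , qb , i~b with CycAdj-atMostTwo i~a i~b i~j
      ...   | inj₁ a≡b        = cong f a≡b
      ...   | inj₂ (inj₁ refl) = ⊥-elim (true≢false (trans (sym qa) q≁fj))
      ...   | inj₂ (inj₂ refl) = ⊥-elim (true≢false (trans (sym qb) q≁fj))

module _ {n} {G : Graph n} (F : Fascinating G) {C : Subset n} (q : Fin n)
         (outside≤2 : deg G q (∁ C) ≤ 2) where
  open Fascinating F

  4≤deg : 4 ≤ deg G q C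
  4≤deg = +-cancelˡ-≤ 2 4 (deg G q C) (begin
    6                           ≤⟨ proj₂ (vertLink q) ⟩
    count (N G q)               ≤⟨ count-split (N G q) C ⟩
    deg G q (∁ C) + deg G q C   ≤⟨ +-mono-≤ outside≤2 ≤-refl ⟩
    2 + deg G q C               ∎)
    where open ≤-Reasoning

  ∃neighbour∈C : ∃ λ w → adj G q w ≡ true × C w ≡ true
  ∃neighbour∈C with w , qw∧Cw ← 0<count⇒∃ {P = N G q ∩ C} (≤-trans (s≤s z≤n) 4≤deg)
    = w , ∧-true qw∧Cw

  2≤count-lkE∩C : ∀ w → adj G q w ≡ true → 2 ≤ count (lkE G q w ∩ C)
  2≤count-lkE∩C w qw with edgeLink q w qw
  ... | len , 4≤len , lk-cycle = +-cancelˡ-≤ 2 2 _ (begin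
    4                                                 ≤⟨ 4≤len ⟩
    len                                               ≤⟨ cycleLength≤count {R = adj G} lk-cycle ⟩
    count (lkE G q w)                                 ≤⟨ count-split (lkE G q w) C ⟩
    count (lkE G q w ∩ ∁ C) + count (lkE G q w ∩ C)   ≤⟨ +-mono-≤ outside ≤-refl ⟩
    2 + count (lkE G q w ∩ C)                         ∎)
    where
    open ≤-Reasoning
    outside : count (lkE G q w ∩ ∁ C) ≤ 2
    outside = ≤-trans (count-mono (∩-monoˡ (∩-⊆ˡ (N G q) (N G w)))) outside≤2

  cycle⊆N : IsCycle (adj G) C → C ⊆ N G q
  cycle⊆N (k , _ , f , _ , C⇔image , adj⇔CycAdj) x Cx
    with i , refl ← Equivalence.to (C⇔image x) Cx
       | w , qw , Cw ← ∃neighbour∈C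
    with _ , refl ← Equivalence.to (C⇔image w) Cw
    = CycAdj-connected (λ i → adj G q (f i) ≡ true) propagate qw i
    where
    C⊆image : ∀ x → C x ≡ true → ∃ λ i → f i ≡ x
    C⊆image x = Equivalence.to (C⇔image x)
    adj⇒CycAdj : ∀ i j → adj G (f i) (f j) ≡ true → CycAdj k i j
    adj⇒CycAdj i j = Equivalence.to (adj⇔CycAdj i j)
    propagate : ∀ {i j} → CycAdj k i j → adj G q (f i) ≡ true → adj G q (f j) ≡ true
    propagate {i} {j} i~j qfi with adj G q (f j) in qfj
    ... | true  = refl
    ... | false with s≤s () ← ≤-trans (2≤count-lkE∩C (f i) qfi)
                                      (count-lkE∩C≤1 G C⊆image adj⇒CycAdj q i~j qfj)

2≤deg-exceptional : ∀ {n} {G : Graph n} → Fascinating G →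
  ∀ {C D X : Subset n} → IsCycle (adj G) C → ∁ C ⊆ (D ∪ X) →
  ∀ {a b} → C a ≡ true → C b ≡ true → (∀ w → lkE G a b w ≡ D w) →
  count X ≡ 2 → ∀ {q} → X q ≡ true → D q ≡ false → 2 ≤ deg G q D
2≤deg-exceptional {G = G} F {C} {D} {X} cyc ∁C⊆D∪X {a} {b} aC bC lk≡D |X|≡2 {q} qX q∉D =
  ≰⇒> λ degD≤1 → true≢false (trans (sym (q∈lk degD≤1)) (trans (lk≡D q) q∉D))
  where
  degX≤1 : deg G q X ≤ 1
  degX≤1 = s≤s⁻¹ (≤-trans (deg<count G qX) (≤-reflexive |X|≡2))
  outside≤2 : deg G q D ≤ 1 → deg G q (∁ C) ≤ 2
  outside≤2 degD≤1 = begin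
    deg G q (∁ C)               ≤⟨ deg-mono G q ∁C⊆D∪X ⟩
    deg G q (D ∪ X)             ≤⟨ deg-∪ G q D X ⟩
    deg G q D + deg G q X       ≤⟨ +-mono-≤ degD≤1 degX≤1 ⟩
    2                           ∎
    where open ≤-Reasoning
  q∈lk : deg G q D ≤ 1 → lkE G a b q ≡ true
  q∈lk degD≤1
    rewrite Graph.sym G a q | Graph.sym G b q
          | cycle⊆N F q (outside≤2 degD≤1) cyc a aC | cycle⊆N F q (outside≤2 degD≤1) cyc b bC
    = refl

∁C₁⊆C₂∪X : ∀ {n} (lab : Fin n → Part) → ∁ (C₁ lab) ⊆ (C₂ lab ∪ X lab)
∁C₁⊆C₂∪X lab x with lab x
... | c₂ = λ _ → refl
... | ex = λ _ → refl

∁C₂⊆C₁∪X : ∀ {n} (lab : Fin n → Part) → ∁ (C₂ lab) ⊆ (C₁ lab ∪ X lab)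
∁C₂⊆C₁∪X lab x with lab x
... | c₁ = λ _ → refl
... | ex = λ _ → refl

proposition4p3 : (n : ℕ) (G : Graph n) → Fascinating G →
    (lab : Fin n → Part) → Joinlike G lab 2 →
    (q : Fin n) → lab q ≡ ex →
    2 ≤ deg G q (C₁ lab) × 2 ≤ deg G q (C₂ lab)
proposition4p3 n G F lab J q q-ex =
    2≤deg-exceptional F cyc₂ (∁C₂⊆C₁∪X lab) (proj₁ e₂-in) (proj₁ (proj₂ e₂-in)) e₂-lk sizeX
                      (cong isX q-ex) (cong isC₁ q-ex)
  , 2≤deg-exceptional F cyc₁ (∁C₁⊆C₂∪X lab) (proj₁ e₁-in) (proj₁ (proj₂ e₁-in)) e₁-lk sizeX
                      (cong isX q-ex) (cong isC₂ q-ex)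
  where open Joinlike J
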